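{- Fix integers $k \geq 2$ and $1 \leq t \leq k/2$. Let $X$ be a set of $n$ elements carrying a fixed but unknown total order, and let $S$ be the set of the $t-1$ smallest and $L$ the set of the $k-t$ largest elements of $X$. Using a $(k,t)$ scale adaptively (each query may depend on the answers to previous queries), one can identify $S \cup L$, split it into the two sets $S$ and $L$, and determine the order of $X \setminus (S \cup L)$, using $O(n \log n)$ queries as $n \to \infty$ with $k,t$ fixed. More precisely, at most $n + 2 n' \log_{k'} n'$ queries suffice, where $n' = n-(k-1)$ and $k' = k-(t-1)$. If the scale is symmetric, the sets $S$ and $L$ are only determined as an unordered pair and the order of $X\setminus(S\cup L)$ only up to reversal.
   Context: A $(k,t)$ scale accepts as input any $k$-element subset of a totally ordered set $X$ (with distinct elements, order unknown to the user) and returns the $t$-th smallest element of that subset; using it on a set is called querying that set. The scale is called symmetric if the position of the returned element is symmetric about the middle of the queried set, in which case the answer to every query is unchanged when the order of $X$ is reversed. Assume $n$ is large compared with $k$. -}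

module Defs where

open import Data.Nat using (ℕ; zero; suc; _+_; _*_; _∸_; _^_; _≤_; _<?_; _≤?_)
open import Data.Fin using (Fin; toℕ)
open import Data.Fin.Subset using (Subset; _∈_; _∩_; ∣_∣)
open import Data.Fin.Permutation using (Permutation′; _⟨$⟩ʳ_)
open import Data.Vec using (tabulate)
open import Data.List using (List; map; upTo; reverse)
open import Data.Product using (_×_; Σ; _,_)
open import Data.Sum using (_⊎_)
open import Relation.Nullary using (does)
open import Relation.Binary.PropositionalEquality using (_≡_)

-- The unknown total order on X = Fin n is given by a rank permutation:
-- x is smaller than y iff rank x < rank y  (rank 0 = smallest element).
Order : ℕ → Set
Order n = Permutation′ n

rank : ∀ {n} → Order n → Fin n → ℕ
rank σ x = toℕ (σ ⟨$⟩ʳ x)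

below : ∀ {n} → Order n → Fin n → Subset n
below σ a = tabulate (λ y → does (rank σ y <? rank σ a))

-- (k,t) scale: a is the t-th smallest element of the queried set Q
IsAnswer : ∀ {n} → ℕ → Order n → Subset n → Fin n → Set
IsAnswer t σ Q a = (a ∈ Q) × (∣ Q ∩ below σ a ∣ ≡ t ∸ 1)

-- adaptive algorithms (decision trees) querying k-element subsets of Fin n,
-- returning a result of type R
data Alg (n k : ℕ) (R : Set) : Set where
  return : R → Alg n k R
  query  : (Q : Subset n) → ∣ Q ∣ ≡ k → (Fin n → Alg n k R) → Alg n k R

data Runs {n k : ℕ} {R : Set} (t : ℕ) (σ : Order n) :
          Alg n k R → R → ℕ → Set where
  ret : ∀ {r} → Runs t σ (return r) r 0
  qry : ∀ {Q p f a r m} → IsAnswer t σ Q a → Runs t σ (f a) r m →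
        Runs t σ (query Q p f) r (suc m)

-- Output: the sets S, L and the list of X \ (S ∪ L) in increasing order
Output : ℕ → Set
Output n = Subset n × Subset n × List (Fin n)

smallSet : ∀ {n} → ℕ → Order n → Subset n
smallSet t σ = tabulate (λ x → does (rank σ x <? t ∸ 1))

largeSet : ∀ {n} → ℕ → ℕ → Order n → Subset n
largeSet {n} k t σ = tabulate (λ x → does (n ∸ (k ∸ t) ≤? rank σ x))

middleRanks : ℕ → ℕ → ℕ → List ℕ
middleRanks n k t = map (λ i → (t ∸ 1) + i) (upTo (n ∸ (k ∸ 1)))

IsMiddleOrder : ∀ {n} → ℕ → ℕ → Order n → List (Fin n) → Set
IsMiddleOrder {n} k t σ M = map (rank σ) M ≡ middleRanks n k t

Correct : ∀ {n} → ℕ → ℕ → Order n → Output n → Set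
Correct k t σ (S , L , M) =
  (S ≡ smallSet t σ) × (L ≡ largeSet k t σ) × IsMiddleOrder k t σ M

CorrectUpToReversal : ∀ {n} → ℕ → ℕ → Order n → Output n → Set
CorrectUpToReversal k t σ (S , L , M) =
  Correct k t σ (S , L , M) ⊎ Correct k t σ (L , S , reverse M)

-- q ≤ n + 2 n' log_{k'} n'  with n' = n-(k-1), k' = k-(t-1),
-- stated exactly without reals as  k'^(q ∸ n) ≤ n'^(2 n')
WithinBound : ℕ → ℕ → ℕ → ℕ → Set
WithinBound n k t q = (k ∸ (t ∸ 1)) ^ (q ∸ n) ≤ (n ∸ (k ∸ 1)) ^ (2 * (n ∸ (k ∸ 1)))

Solves : ∀ {n k} → ℕ → (Order n → Output n → Set) → Alg n k (Output n) → Set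
Solves {n} {k} t Good A =
  ∀ (σ : Order n) (r : Output n) (m : ℕ) → Runs t σ A r m →
    WithinBound n k t m × Good σ r

module Submission where

-- Write t = s + 1 and k = s + 1 + j.  The answer to a query of k distinct elements has s of them
-- below and j above it, so it is a middle element: neither among the s smallest elements (S) nor
-- among the j largest (L).  Keeping a pool of k elements and discarding each answer, n - (k - 1)
-- queries separate X into P = S ∪ L and the n' = n - (s + j) middle elements.  Querying P without p
-- together with two middle elements m, m' returns the larger of m, m' iff p is small, which splits P
-- into S and L up to a swap; comparing sizes undoes the swap unless |S| = |L|, i.e. unless the scale
-- is symmetric.  Finally the middle elements are sorted by a (j + 1)-way merge sort, since the query
-- formed by S, at most j + 1 candidates and enough elements of L returns the least candidate (the
-- greatest one if S and L were swapped).  Each of the ⌈log_{j+1} n'⌉ levels of the merge sort costs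
-- n' queries and (j + 1)^⌈log_{j+1} n'⌉ ≤ n'², whence (j + 1)^(q - n) ≤ n'^(2n').

open import Defs
open import Data.Bool using (Bool; _∧_; if_then_else_)
open import Data.Empty using (⊥)
open import Data.Fin as Fin using (Fin)
import Data.Fin.Properties as Fin
open import Data.Fin.Permutation using (_⟨$⟩ʳ_; _⟨$⟩ˡ_; inverseˡ; inverseʳ)
open import Data.Fin.Subset using (Subset; _∩_; ∣_∣) renaming (⊥ to ∅; _∈_ to _∈ₛ_)
open import Data.List
  using (List; []; _∷_; _++_; length; map; filter; take; drop; concat; reverse; applyUpTo; upTo; allFin)
import Data.List as List
open import Data.List.Properties
  using ( length-++; length-map; length-take; length-drop; length-tabulate; length-upTo; length-applyUpTo
        ; unfold-reverse; take++drop≡id; ++-identityʳ; map-upTo; map-cong; filter-++; filter-all; filter-none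
        ; filter-reject)
open import Data.List.Membership.Propositional using (_∈_)
open import Data.List.Membership.Propositional.Properties
  using (∈-allFin; ∈-upTo⁻; ∈-∃++; ∈-++⁺ˡ; ∈-++⁺ʳ; ∈-++⁻; ∈-filter⁺; ∈-filter⁻; ∈-map⁺; ∈-applyUpTo⁺)
open import Data.List.Relation.Binary.Permutation.Propositional
  using (_↭_; ↭-refl; ↭-sym; ↭-trans; prep; swap; ↭⇒↭ₛ; module PermutationReasoning)
open import Data.List.Relation.Binary.Permutation.Propositional.Properties
  using (↭-length; ↭-reverse; ∈-resp-↭; filter-↭; shift; ++⁺; ++⁺ˡ; ++⁺ʳ; ++-comm)
import Data.List.Relation.Binary.Permutation.Setoid.Properties as PermutationSetoid
open import Data.List.Relation.Binary.Subset.Propositional using (_⊆_)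
open import Data.List.Relation.Unary.All as All using (All; []; _∷_)
import Data.List.Relation.Unary.All.Properties as All
open import Data.List.Relation.Unary.AllPairs as AllPairs using (AllPairs; []; _∷_)
import Data.List.Relation.Unary.AllPairs.Properties as AllPairs
open import Data.List.Relation.Unary.Any using (here; there)
open import Data.List.Relation.Unary.Unique.Propositional using (Unique)
import Data.List.Relation.Unary.Unique.Propositional.Properties as Unique
open import Data.Nat
open import Data.Nat.Properties
open import Data.Product as Product using (_×_; _,_; proj₁; proj₂; ∃-syntax)
open import Data.Sum using (_⊎_; inj₁; inj₂; [_,_])
import Data.Vec as Vec
open import Data.Vec.Properties using (lookup∘tabulate; []=⇒lookup; tabulate-cong)
open import Function using (id; _∘_; _⇔_; mk⇔; Equivalence)
open import Relation.Binary.Definitions using (DecidableEquality; tri<; tri≈; tri>)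
open import Relation.Binary.PropositionalEquality hiding ([_])
open import Relation.Nullary using (¬_; yes; no; does; _×-dec_; contradiction)
open import Relation.Nullary.Decidable using (does-⇔)
open import Relation.Unary using (Decidable; ∁)
open import Relation.Unary.Properties using (∁?)

-- Counting in lists without repetitions

module _ {A : Set} where

  Unique⇒length≤ : {xs ys : List A} → Unique xs → xs ⊆ ys → length xs ≤ length ys
  Unique⇒length≤ {[]} _ _ = z≤n
  Unique⇒length≤ {x ∷ xs} (x∉xs ∷ u) xs⊆ys with ∈-∃++ (xs⊆ys (here refl))
  ... | us , vs , refl = begin
    suc (length xs)              ≤⟨ s≤s (Unique⇒length≤ u xs⊆us++vs) ⟩
    suc (length (us ++ vs))      ≡⟨ cong suc (length-++ us) ⟩
    suc (length us + length vs)  ≡⟨ +-suc (length us) (length vs) ⟨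
    length us + length (x ∷ vs)  ≡⟨ length-++ us ⟨
    length (us ++ x ∷ vs)        ∎
    where
    open ≤-Reasoning
    drop-x : ∀ {y} → y ∈ us ++ x ∷ vs → y ≢ x → y ∈ us ++ vs
    drop-x y∈ y≢x with ∈-++⁻ us y∈
    ... | inj₁ y∈us = ∈-++⁺ˡ y∈us
    ... | inj₂ (here y≡x) = contradiction y≡x y≢x
    ... | inj₂ (there y∈vs) = ∈-++⁺ʳ us y∈vs
    xs⊆us++vs : xs ⊆ us ++ vs
    xs⊆us++vs y∈xs = drop-x (xs⊆ys (there y∈xs)) (≢-sym (All.lookup x∉xs y∈xs))

  Unique⇒length≡ : {xs ys : List A} → Unique xs → Unique ys → xs ⊆ ys → ys ⊆ xs →
                   length xs ≡ length ys
  Unique⇒length≡ uxs uys xs⊆ys ys⊆xs =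
    ≤-antisym (Unique⇒length≤ uxs xs⊆ys) (Unique⇒length≤ uys ys⊆xs)

  Unique-++⁻ˡ : ∀ (xs : List A) {ys} → Unique (xs ++ ys) → Unique xs
  Unique-++⁻ˡ [] _ = []
  Unique-++⁻ˡ (x ∷ xs) (x∉ ∷ u) = All.++⁻ˡ xs x∉ ∷ Unique-++⁻ˡ xs u

  Unique-++⁻ʳ : ∀ (xs : List A) {ys} → Unique (xs ++ ys) → Unique ys
  Unique-++⁻ʳ [] u = u
  Unique-++⁻ʳ (x ∷ xs) (_ ∷ u) = Unique-++⁻ʳ xs u

  Unique-++⇒disjoint : ∀ (xs : List A) {ys x} → Unique (xs ++ ys) → x ∈ xs → x ∈ ys → ⊥
  Unique-++⇒disjoint (x ∷ xs) (x∉ ∷ _) (here refl) x∈ys = All.lookup (All.++⁻ʳ xs x∉) x∈ys refl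
  Unique-++⇒disjoint (x ∷ xs) (_ ∷ u) (there x∈xs) x∈ys = Unique-++⇒disjoint xs u x∈xs x∈ys

Unique-resp-↭ : ∀ {A : Set} {xs ys : List A} → xs ↭ ys → Unique xs → Unique ys
Unique-resp-↭ {A} xs↭ys = PermutationSetoid.Unique-resp-↭ (setoid A) (↭⇒↭ₛ xs↭ys)

AllPairs-reverse⁺ : ∀ {A : Set} {R : A → A → Set} {xs : List A} →
                    AllPairs R xs → AllPairs (λ x y → R y x) (reverse xs)
AllPairs-reverse⁺ {xs = []} [] = []
AllPairs-reverse⁺ {R = R} {xs = x ∷ xs} (x<xs ∷ ↑xs) =
  subst (AllPairs (λ x y → R y x)) (sym (unfold-reverse x xs))
    (AllPairs.++⁺ (AllPairs-reverse⁺ ↑xs) ([] ∷ [])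
      (All.tabulate λ y∈ → All.lookup x<xs (∈-resp-↭ (↭-reverse xs) y∈) ∷ []))

module _ {A : Set} {P : A → Set} (P? : Decidable P) where

  count : List A → ℕ
  count xs = length (filter P? xs)

  count-++ : ∀ xs ys → count (xs ++ ys) ≡ count xs + count ys
  count-++ xs ys = trans (cong length (filter-++ P? xs ys)) (length-++ (filter P? xs))

  count-all : ∀ {xs} → All P xs → count xs ≡ length xs
  count-all all = cong length (filter-all P? all)

  count-none : ∀ {xs} → All (∁ P) xs → count xs ≡ 0
  count-none none = cong length (filter-none P? none)

  count≡0⇒none : ∀ xs → count xs ≡ 0 → All (∁ P) xs
  count≡0⇒none [] _ = []
  count≡0⇒none (x ∷ xs) c≡0 with P? x
  ... | no ¬px = ¬px ∷ count≡0⇒none xs c≡0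

  count-↭ : ∀ {xs ys} → xs ↭ ys → count xs ≡ count ys
  count-↭ xs↭ys = ↭-length (filter-↭ P? xs↭ys)

module _ {A : Set} {P : A → Set} (P? : Decidable P) where

  count+count-∁ : ∀ xs → count P? xs + count (∁? P?) xs ≡ length xs
  count+count-∁ [] = refl
  count+count-∁ (x ∷ xs) with P? x
  ... | yes _ = cong suc (count+count-∁ xs)
  ... | no _ = trans (+-suc _ _) (cong suc (count+count-∁ xs))

  count≡length-1⇒ : ∀ {x xs} → x ∈ xs → ¬ P x → suc (count P? xs) ≡ length xs →
                    ∀ {y} → y ∈ xs → y ≢ x → P y
  count≡length-1⇒ {x} {xs} x∈xs ¬px |xs|≡ {y} y∈xs y≢x with P? y
  ... | yes py = py
  ... | no ¬py = contradiction |xs|≡ (<⇒≢ (begin-strict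
      suc (count P? xs)                  ≡⟨ +-comm 1 (count P? xs) ⟩
      count P? xs + 1                    <⟨ +-monoʳ-< (count P? xs) two≤ ⟩
      count P? xs + count (∁? P?) xs     ≡⟨ count+count-∁ xs ⟩
      length xs                          ∎))
    where
    open ≤-Reasoning
    two≤ : 2 ≤ count (∁? P?) xs
    two≤ = Unique⇒length≤ ((≢-sym y≢x ∷ []) ∷ [] ∷ []) λ
      { (here refl) → ∈-filter⁺ (∁? P?) x∈xs ¬px
      ; (there (here refl)) → ∈-filter⁺ (∁? P?) y∈xs ¬py
      }

count-singleton⇒⇔ : ∀ {A B : Set} {P : A → Set} {Q : B → Set} (P? : Decidable P) (Q? : Decidable Q)
                    {x y} → count P? (x ∷ []) ≡ count Q? (y ∷ []) → P x ⇔ Q y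
count-singleton⇒⇔ P? Q? {x} {y} eq with P? x | Q? y
... | yes px | yes qy = mk⇔ (λ _ → qy) (λ _ → px)
... | no ¬px | no ¬qy = mk⇔ (λ px → contradiction px ¬px) (λ qy → contradiction qy ¬qy)
count-singleton⇒⇔ P? Q? () | yes _ | no _
count-singleton⇒⇔ P? Q? () | no _ | yes _

count-cong : ∀ {A : Set} {P Q : A → Set} (P? : Decidable P) (Q? : Decidable Q) {xs} →
             All (λ x → P x ⇔ Q x) xs → count P? xs ≡ count Q? xs
count-cong P? Q? [] = refl
count-cong P? Q? {x ∷ xs} (p⇔q ∷ ps) with P? x | Q? x
... | yes _ | yes _ = cong suc (count-cong P? Q? ps)
... | no _ | no _ = count-cong P? Q? ps
... | yes p | no ¬q = contradiction (Equivalence.to p⇔q p) ¬q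
... | no ¬p | yes q = contradiction (Equivalence.from p⇔q q) ¬p

Unique⇒length≤-interval : ∀ {lo hi} {vs : List ℕ} → Unique vs →
                          All (λ v → lo ≤ v × v < hi) vs → length vs ≤ hi ∸ lo
Unique⇒length≤-interval {lo} {hi} {vs} u bounds =
  subst (length vs ≤_) (length-applyUpTo (lo +_) (hi ∸ lo)) (Unique⇒length≤ u vs⊆)
  where
  vs⊆ : vs ⊆ applyUpTo (lo +_) (hi ∸ lo)
  vs⊆ v∈ with All.lookup bounds v∈
  ... | lo≤v , v<hi =
    subst (_∈ _) (m+[n∸m]≡n lo≤v) (∈-applyUpTo⁺ (lo +_) (∸-monoˡ-< v<hi lo≤v))

increasing-interval⇒≡applyUpTo : ∀ m lo {vs : List ℕ} → AllPairs _<_ vs →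
                                 All (λ v → lo ≤ v × v < lo + m) vs → length vs ≡ m →
                                 vs ≡ applyUpTo (lo +_) m
increasing-interval⇒≡applyUpTo zero lo {[]} _ _ _ = refl
increasing-interval⇒≡applyUpTo (suc m) lo {v ∷ ws} (v<ws ∷ ↑ws) ((lo≤v , v<) ∷ bounds) len =
  cong₂ _∷_ (trans v≡lo (sym (+-identityʳ lo)))
            (trans ws≡ (applyUpTo-cong (λ i → sym (+-suc lo i)) m))
  where
  |ws|≡m : length ws ≡ m
  |ws|≡m = suc-injective len
  ws-bounds : All (λ w → suc v ≤ w × w < lo + suc m) ws
  ws-bounds = All.zipWith (λ (v<w , _ , w<) → v<w , w<) (v<ws , bounds)
  m≤ : m ≤ (lo + suc m) ∸ suc v
  m≤ = subst (_≤ _) |ws|≡m (Unique⇒length≤-interval (AllPairs.map <⇒≢ ↑ws) ws-bounds)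
  v≤lo : v ≤ lo
  v≤lo = +-cancelˡ-≤ m v lo (≤-pred (begin
    suc (m + v)                   ≡⟨ +-suc m v ⟨
    m + suc v                     ≤⟨ +-monoˡ-≤ (suc v) m≤ ⟩
    (lo + suc m) ∸ suc v + suc v  ≡⟨ m∸n+n≡m v< ⟩
    lo + suc m                    ≡⟨ +-suc lo m ⟩
    suc (lo + m)                  ≡⟨ cong suc (+-comm lo m) ⟩
    suc (m + lo)                  ∎))
    where open ≤-Reasoning
  v≡lo : v ≡ lo
  v≡lo = ≤-antisym v≤lo lo≤v
  ws≡ : ws ≡ applyUpTo (suc lo +_) m
  ws≡ = increasing-interval⇒≡applyUpTo m (suc lo) ↑ws
          (All.map (λ {w} (v<w , w<) → subst (_≤ w) (cong suc v≡lo) v<w , subst (w <_) (+-suc lo m) w<)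
                   ws-bounds)
          |ws|≡m
  applyUpTo-cong : ∀ {f g : ℕ → ℕ} → (∀ i → f i ≡ g i) → ∀ k →
                   applyUpTo f k ≡ applyUpTo g k
  applyUpTo-cong {f} {g} f≗g k =
    trans (sym (map-upTo f k)) (trans (map-cong f≗g (upTo k)) (map-upTo g k))

module _ {A : Set} (_≟_ : DecidableEquality A) where

  remove : A → List A → List A
  remove a [] = []
  remove a (x ∷ xs) with x ≟ a
  ... | yes _ = xs
  ... | no _ = x ∷ remove a xs

  ↭-remove : ∀ {a} xs → a ∈ xs → xs ↭ a ∷ remove a xs
  ↭-remove {a} (x ∷ xs) a∈ with x ≟ a
  ... | yes refl = ↭-refl
  ↭-remove (x ∷ xs) (here refl) | no x≢a = contradiction refl x≢a
  ↭-remove {a} (x ∷ xs) (there a∈) | no _ = ↭-trans (prep x (↭-remove xs a∈)) (swap x a ↭-refl)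

  length-remove : ∀ {a xs} → a ∈ xs → length xs ≡ suc (length (remove a xs))
  length-remove a∈ = ↭-length (↭-remove _ a∈)

  ↭-refill : ∀ {a x rest} pool → a ∈ pool → pool ++ x ∷ rest ↭ a ∷ (x ∷ remove a pool) ++ rest
  ↭-refill {a} {x} {rest} pool a∈pool = begin
    pool ++ x ∷ rest                 ↭⟨ shift x pool rest ⟩
    x ∷ pool ++ rest                 ↭⟨ prep x (++⁺ʳ rest (↭-remove pool a∈pool)) ⟩
    x ∷ a ∷ remove a pool ++ rest    ↭⟨ swap x a ↭-refl ⟩
    a ∷ x ∷ remove a pool ++ rest    ∎
    where open PermutationReasoning

-- Subsets of Fin n given by lists

∣tabulate∣≡count : ∀ {n} {A : Set} {P : A → Set} (P? : Decidable P) (f : Fin n → A) →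
                   ∣ Vec.tabulate (does ∘ P? ∘ f) ∣ ≡ count P? (List.tabulate f)
∣tabulate∣≡count {zero} P? f = refl
∣tabulate∣≡count {suc n} P? f with P? (f Fin.zero)
... | yes _ = cong suc (∣tabulate∣≡count P? (f ∘ Fin.suc))
... | no _ = ∣tabulate∣≡count P? (f ∘ Fin.suc)

module _ {n : ℕ} where

  open import Data.List.Membership.DecPropositional (Fin._≟_ {n}) using (_∈?_)

  toSubset : List (Fin n) → Subset n
  toSubset qs = Vec.tabulate (λ x → does (x ∈? qs))

  ∣toSubset∩∣≡count : ∀ {P} (P? : Decidable P) {qs} → Unique qs →
                      ∣ toSubset qs ∩ Vec.tabulate (does ∘ P?) ∣ ≡ count P? qs
  ∣toSubset∩∣≡count {P} P? {qs} u = begin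
    ∣ toSubset qs ∩ Vec.tabulate (does ∘ P?) ∣
      ≡⟨ cong ∣_∣ (zipWith-tabulate (λ x → does (x ∈? qs)) (does ∘ P?)) ⟩
    ∣ Vec.tabulate (does ∘ ∈qs∧P?) ∣
      ≡⟨ ∣tabulate∣≡count ∈qs∧P? id ⟩
    count ∈qs∧P? (allFin n)
      ≡⟨ Unique⇒length≡ (Unique.filter⁺ ∈qs∧P? (Unique.allFin⁺ n)) (Unique.filter⁺ P? u)
                         ⊆P P⊆ ⟩
    count P? qs
      ∎
    where
    open ≡-Reasoning
    ∈qs∧P? : Decidable (λ x → x ∈ qs × P x)
    ∈qs∧P? x = (x ∈? qs) ×-dec P? x
    ⊆P : filter ∈qs∧P? (allFin n) ⊆ filter P? qs
    ⊆P x∈ = let (_ , x∈qs , px) = ∈-filter⁻ ∈qs∧P? {xs = allFin n} x∈ in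
            ∈-filter⁺ P? x∈qs px
    P⊆ : filter P? qs ⊆ filter ∈qs∧P? (allFin n)
    P⊆ {x} x∈ = ∈-filter⁺ ∈qs∧P? (∈-allFin x) (∈-filter⁻ P? {xs = qs} x∈)
    zipWith-tabulate : ∀ {m} (f g : Fin m → Bool) →
                       Vec.zipWith _∧_ (Vec.tabulate f) (Vec.tabulate g) ≡
                       Vec.tabulate (λ x → f x ∧ g x)
    zipWith-tabulate {zero} f g = refl
    zipWith-tabulate {suc m} f g =
      cong (f Fin.zero ∧ g Fin.zero Vec.∷_) (zipWith-tabulate (f ∘ Fin.suc) (g ∘ Fin.suc))

  ∣toSubset∣≡length : ∀ {qs} → Unique qs → ∣ toSubset qs ∣ ≡ length qs
  ∣toSubset∣≡length {qs} u =
    trans (∣tabulate∣≡count (_∈? qs) id)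
          (Unique⇒length≡ (Unique.filter⁺ (_∈? qs) (Unique.allFin⁺ n)) u
            (λ x∈ → proj₂ (∈-filter⁻ (_∈? qs) {xs = allFin n} x∈))
            (λ {x} x∈ → ∈-filter⁺ (_∈? qs) (∈-allFin x) x∈))

  toSubset-cong : ∀ {qs} {P : Fin n → Set} (P? : Decidable P) → (∀ x → x ∈ qs ⇔ P x) →
                  toSubset qs ≡ Vec.tabulate (does ∘ P?)
  toSubset-cong {qs} P? ∈⇔P = tabulate-cong λ x → does-⇔ (∈⇔P x) (x ∈? qs) (P? x)

  ∈toSubset⇒∈ : ∀ {qs a} → a ∈ₛ toSubset qs → a ∈ qs
  ∈toSubset⇒∈ {qs} {a} a∈
    with a ∈? qs | trans (sym (lookup∘tabulate (λ x → does (x ∈? qs)) a)) ([]=⇒lookup a∈)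
  ... | yes a∈qs | _ = a∈qs
  ... | no _ | ()

-- Ceiling logarithm

n<b^n : ∀ {b} → 2 ≤ b → ∀ n → n < b ^ n
n<b^n {b} 2≤b zero = s≤s z≤n
n<b^n {b} 2≤b (suc n) = begin-strict
  suc n          <⟨ s≤s (n<b^n 2≤b n) ⟩
  suc (b ^ n)    ≡⟨ +-comm 1 (b ^ n) ⟩
  b ^ n + 1      ≤⟨ +-monoʳ-≤ (b ^ n) (≤-trans (s≤s z≤n) (n<b^n 2≤b n)) ⟩
  b ^ n + b ^ n  ≡⟨ cong (b ^ n +_) (sym (+-identityʳ (b ^ n))) ⟩
  2 * b ^ n      ≤⟨ *-monoˡ-≤ (b ^ n) 2≤b ⟩
  b ^ suc n      ∎
  where open ≤-Reasoning

logSearch : (b m fuel d : ℕ) → ℕ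
logSearch b m zero d = d
logSearch b m (suc fuel) d with m ≤? b ^ d
... | yes _ = d
... | no _ = logSearch b m fuel (suc d)

⌈log[_]_⌉ : ℕ → ℕ → ℕ
⌈log[ b ] m ⌉ = logSearch b m m 0

⌈log⌉-spec : ∀ {b m} → 2 ≤ b → 1 ≤ m →
             m ≤ b ^ ⌈log[ b ] m ⌉ × b ^ ⌈log[ b ] m ⌉ ≤ b * m
⌈log⌉-spec {b} {m} 2≤b 1≤m with search m 0 (inj₁ refl) (<⇒≤ (n<b^n 2≤b m))
  where
  -- invariant: d is 0 or b ^ (d - 1) < m, and the fuel suffices to reach a d with m ≤ b ^ d
  search : ∀ fuel d → d ≡ 0 ⊎ b ^ pred d < m → m ≤ b ^ (d + fuel) →
           let D = logSearch b m fuel d in m ≤ b ^ D × (D ≡ 0 ⊎ b ^ pred D < m)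
  search zero d inv m≤ = subst (λ e → m ≤ b ^ e) (+-identityʳ d) m≤ , inv
  search (suc fuel) d inv m≤ with m ≤? b ^ d
  ... | yes m≤b^d = m≤b^d , inv
  ... | no m≰b^d =
    search fuel (suc d) (inj₂ (≰⇒> m≰b^d)) (subst (λ e → m ≤ b ^ e) (+-suc d fuel) m≤)
... | m≤b^D , D≡0⊎b^D-1<m = m≤b^D , b^D≤b*m ⌈log[ b ] m ⌉ D≡0⊎b^D-1<m
  where
  b^D≤b*m : ∀ D → D ≡ 0 ⊎ b ^ pred D < m → b ^ D ≤ b * m
  b^D≤b*m zero _ =
    ≤-trans 1≤m (subst (_≤ b * m) (*-identityˡ m) (*-monoˡ-≤ m (≤-trans (s≤s z≤n) 2≤b)))
  b^D≤b*m (suc D) (inj₂ b^D<m) = *-monoʳ-≤ b (<⇒≤ b^D<m)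

b^c≤m^2m : ∀ {b m c} → 2 ≤ b → b ≤ m → c ≤ ⌈log[ b ] m ⌉ * m → b ^ c ≤ m ^ (2 * m)
b^c≤m^2m {b} {m} {c} 2≤b b≤m c≤Dm = begin
  b ^ c              ≤⟨ ^-monoʳ-≤ b c≤Dm ⟩
  b ^ (D * m)        ≡⟨ sym (^-*-assoc b D m) ⟩
  (b ^ D) ^ m        ≤⟨ ^-monoˡ-≤ m b^D≤m*m ⟩
  (m * m) ^ m        ≡⟨ cong (λ x → (m * x) ^ m) (sym (*-identityʳ m)) ⟩
  (m ^ 2) ^ m        ≡⟨ ^-*-assoc m 2 m ⟩
  m ^ (2 * m)        ∎
  where
  open ≤-Reasoning
  D = ⌈log[ b ] m ⌉
  1≤m : 1 ≤ m
  1≤m = ≤-trans (s≤s z≤n) (≤-trans 2≤b b≤m)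
  b^D≤m*m : b ^ D ≤ m * m
  b^D≤m*m = ≤-trans (proj₂ (⌈log⌉-spec 2≤b 1≤m)) (*-monoˡ-≤ m b≤m)
  instance
    b≢0 : NonZero b
    b≢0 = >-nonZero (≤-trans (s≤s z≤n) 2≤b)

-- Heads and chunks of lists of lists

heads : {A : Set} → List (List A) → List A
heads [] = []
heads ([] ∷ xss) = heads xss
heads ((x ∷ _) ∷ xss) = x ∷ heads xss

module _ {A : Set} where

  heads⊆concat : ∀ (xss : List (List A)) → heads xss ⊆ concat xss
  heads⊆concat ([] ∷ xss) x∈ = heads⊆concat xss x∈
  heads⊆concat ((x ∷ xs) ∷ xss) (here refl) = here refl
  heads⊆concat ((x ∷ xs) ∷ xss) (there x∈) = there (∈-++⁺ʳ xs (heads⊆concat xss x∈))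

  length-heads≤ : ∀ (xss : List (List A)) → length (heads xss) ≤ length xss
  length-heads≤ [] = z≤n
  length-heads≤ ([] ∷ xss) = m≤n⇒m≤1+n (length-heads≤ xss)
  length-heads≤ ((x ∷ xs) ∷ xss) = s≤s (length-heads≤ xss)

  Unique-heads : ∀ (xss : List (List A)) → Unique (concat xss) → Unique (heads xss)
  Unique-heads [] _ = []
  Unique-heads ([] ∷ xss) u = Unique-heads xss u
  Unique-heads ((x ∷ xs) ∷ xss) (x∉ ∷ u) =
    All.anti-mono (∈-++⁺ʳ xs ∘ heads⊆concat xss) x∉ ∷ Unique-heads xss (Unique-++⁻ʳ xs u)

  heads-nonempty : ∀ (xss : List (List A)) → 0 < length (concat xss) → 0 < length (heads xss)
  heads-nonempty ([] ∷ xss) 0<∣xss∣ = heads-nonempty xss 0<∣xss∣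
  heads-nonempty ((x ∷ xs) ∷ xss) _ = s≤s z≤n

  heads-lower-bound : ∀ (key : A → ℕ) {b} xss → All (AllPairs (λ x y → key x < key y)) xss →
                      All (λ h → b ≤ key h) (heads xss) → All (λ x → b ≤ key x) (concat xss)
  heads-lower-bound key [] [] _ = []
  heads-lower-bound key ([] ∷ xss) (_ ∷ ↑xss) bounds = heads-lower-bound key xss ↑xss bounds
  heads-lower-bound key ((x ∷ xs) ∷ xss) ((x<xs ∷ _) ∷ ↑xss) (b≤x ∷ bounds) =
    All.++⁺ (b≤x ∷ All.map (λ x<y → ≤-trans b≤x (<⇒≤ x<y)) x<xs)
            (heads-lower-bound key xss ↑xss bounds)

module _ {A : Set} (_≟_ : DecidableEquality A) where

  popHead : A → List (List A) → List (List A)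
  popHead a [] = []
  popHead a ([] ∷ xss) = [] ∷ popHead a xss
  popHead a ((x ∷ xs) ∷ xss) with x ≟ a
  ... | yes _ = xs ∷ xss
  ... | no _ = (x ∷ xs) ∷ popHead a xss

  ↭-popHead : ∀ {a} (xss : List (List A)) → a ∈ heads xss →
              concat xss ↭ a ∷ concat (popHead a xss)
  ↭-popHead ([] ∷ xss) a∈ = ↭-popHead xss a∈
  ↭-popHead {a} ((x ∷ xs) ∷ xss) a∈ with x ≟ a
  ... | yes refl = ↭-refl
  ↭-popHead ((x ∷ xs) ∷ xss) (here refl) | no x≢a = contradiction refl x≢a
  ↭-popHead {a} ((x ∷ xs) ∷ xss) (there a∈) | no _ =
    ↭-trans (++⁺ˡ (x ∷ xs) (↭-popHead xss a∈)) (shift a (x ∷ xs) (concat (popHead a xss)))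

  length-popHead : ∀ a (xss : List (List A)) → length (popHead a xss) ≡ length xss
  length-popHead a [] = refl
  length-popHead a ([] ∷ xss) = cong suc (length-popHead a xss)
  length-popHead a ((x ∷ xs) ∷ xss) with x ≟ a
  ... | yes _ = refl
  ... | no _ = cong suc (length-popHead a xss)

  popHead⁺ : ∀ {R : A → A → Set} a {xss} → All (AllPairs R) xss →
             All (AllPairs R) (popHead a xss)
  popHead⁺ a [] = []
  popHead⁺ a {[] ∷ xss} (↑xs ∷ ↑xss) = ↑xs ∷ popHead⁺ a ↑xss
  popHead⁺ a {(x ∷ xs) ∷ xss} (↑xs ∷ ↑xss) with x ≟ a
  ... | yes _ = AllPairs.tail ↑xs ∷ ↑xss
  ... | no _ = ↑xs ∷ popHead⁺ a ↑xss

chunks : {A : Set} → ℕ → ℕ → List A → List (List A)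
chunks zero size xs = []
chunks (suc c) size xs = take size xs ∷ chunks c size (drop size xs)

module _ {A : Set} where

  concat-chunks : ∀ c size (xs : List A) → length xs ≤ c * size → concat (chunks c size xs) ≡ xs
  concat-chunks zero size [] _ = refl
  concat-chunks (suc c) size xs |xs|≤ = begin
    take size xs ++ concat (chunks c size (drop size xs))
      ≡⟨ cong (take size xs ++_) (concat-chunks c size (drop size xs) |drop|≤) ⟩
    take size xs ++ drop size xs
      ≡⟨ take++drop≡id size xs ⟩
    xs
      ∎
    where
    open ≡-Reasoning
    |drop|≤ : length (drop size xs) ≤ c * size
    |drop|≤ =
      subst₂ _≤_ (sym (length-drop size xs)) (m+n∸m≡n size (c * size)) (∸-monoˡ-≤ size |xs|≤)

  length-chunks : ∀ c size (xs : List A) → length (chunks c size xs) ≡ c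
  length-chunks zero size xs = refl
  length-chunks (suc c) size xs = cong suc (length-chunks c size (drop size xs))

  chunks-bounded : ∀ c size (xs : List A) → All (λ ys → length ys ≤ size) (chunks c size xs)
  chunks-bounded zero size xs = []
  chunks-bounded (suc c) size xs =
    subst (_≤ size) (sym (length-take size xs)) (m⊓n≤m size (length xs)) ∷
    chunks-bounded c size (drop size xs)

-- Adaptive algorithms as a monad

module _ {n k : ℕ} where

  infixl 1 _>>=_

  _>>=_ : {A B : Set} → Alg n k A → (A → Alg n k B) → Alg n k B
  return x >>= f = f x
  query Q ∣Q∣≡k g >>= f = query Q ∣Q∣≡k (λ a → g a >>= f)

  _<$>_ : {A B : Set} → (A → B) → Alg n k A → Alg n k B
  f <$> p = p >>= return ∘ f

  mapM : {A B : Set} → (A → Alg n k B) → List A → Alg n k (List B)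
  mapM f [] = return []
  mapM f (x ∷ xs) = f x >>= λ y → (y ∷_) <$> mapM f xs

  module _ {t : ℕ} {σ : Order n} {A B : Set} where

    Runs->>=⁻ : ∀ (p : Alg n k A) {f : A → Alg n k B} {y m} → Runs t σ (p >>= f) y m →
                ∃[ x ] ∃[ m₁ ] ∃[ m₂ ]
                  Runs t σ p x m₁ × Runs t σ (f x) y m₂ × m ≡ m₁ + m₂
    Runs->>=⁻ (return x) run = x , 0 , _ , ret , run , refl
    Runs->>=⁻ (query Q ∣Q∣≡k g) (qry a∈ run) with Runs->>=⁻ (g _) run
    ... | x , m₁ , m₂ , run₁ , run₂ , refl = x , suc m₁ , m₂ , qry a∈ run₁ , run₂ , refl

    Runs-<$>⁻ : ∀ (p : Alg n k A) {f : A → B} {y m} → Runs t σ (f <$> p) y m →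
                ∃[ x ] Runs t σ p x m × y ≡ f x
    Runs-<$>⁻ p run with Runs->>=⁻ p run
    ... | x , m₁ , _ , run₁ , ret , refl = x , subst (Runs t σ p x) (sym (+-identityʳ m₁)) run₁ , refl

module Algorithm {n : ℕ} (x₀ : Fin n) (s j : ℕ) where

  k : ℕ
  k = suc (s + j)

  Prog : Set → Set
  Prog = Alg n k

  -- x₀ answers malformed queries, which the algorithm never makes
  ask : List (Fin n) → Prog (Fin n)
  ask qs with ∣ toSubset qs ∣ ≟ k
  ... | yes ∣qs∣≡k = query (toSubset qs) ∣qs∣≡k return
  ... | no _ = return x₀

  eliminate : (pool rest : List (Fin n)) → Prog (List (Fin n) × List (Fin n))
  eliminate pool [] = ask pool >>= λ a → return (remove Fin._≟_ a pool , a ∷ [])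
  eliminate pool (x ∷ rest) =
    ask pool >>= λ a → Product.map₂ (a ∷_) <$> eliminate (x ∷ remove Fin._≟_ a pool) rest

  classify : (P : List (Fin n)) (m m' : Fin n) → List (Fin n) → Prog (List (Fin n) × List (Fin n))
  classify P m m' [] = return ([] , [])
  classify P m m' (p ∷ ps) =
    ask (remove Fin._≟_ p P ++ m ∷ m' ∷ []) >>= λ a → place a <$> classify P m m' ps
    where
    place : Fin n → List (Fin n) × List (Fin n) → List (Fin n) × List (Fin n)
    place a (A , B) = if does (a Fin.≟ m) then (p ∷ A , B) else (A , p ∷ B)

  orient : List (Fin n) × List (Fin n) → List (Fin n) × List (Fin n)
  orient (A , B) with length A ≟ s
  ... | yes _ = A , B
  ... | no _ = B , A

  minQuery : List (Fin n) → List (Fin n) → List (Fin n) → List (Fin n)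
  minQuery S L W = S ++ W ++ take (suc j ∸ length W) L

  merge : (List (Fin n) → List (Fin n)) → ℕ → List (List (Fin n)) → Prog (List (Fin n))
  merge q zero xss = return []
  merge q (suc size) xss =
    ask (q (heads xss)) >>= λ a → (a ∷_) <$> merge q size (popHead Fin._≟_ a xss)

  sort : (List (Fin n) → List (Fin n)) → ℕ → List (Fin n) → Prog (List (Fin n))
  sort q zero xs = return xs
  sort q (suc d) xs = mapM (sort q d) (chunks (suc j) (suc j ^ d) xs) >>= merge q (length xs)

  -- n' = n - (k - 1) is the number of middle elements
  n' depth : ℕ
  n' = n ∸ (s + j)
  depth = ⌈log[ suc j ] n' ⌉

  splitAndSort : List (Fin n) × List (Fin n) → Prog (Output n)
  splitAndSort (P , E@(m ∷ m' ∷ _)) =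
    orient <$> classify P m m' P >>= λ (S , L) →
    sort (minQuery S L) depth E >>= λ M →
    return (toSubset S , toSubset L , M)
  splitAndSort _ = return (∅ , ∅ , [])  -- unreachable: there are n' ≥ 2 middle elements

  algorithm : Prog (Output n)
  algorithm = eliminate (take k (allFin n)) (drop k (allFin n)) >>= splitAndSort

reversed : ∀ {n} → Output n → Output n
reversed (S , L , M) = L , S , reverse M

Solution : ∀ {n} → ℕ → ℕ → Order n → Output n → Set
Solution s j σ out =
  Correct (suc (s + j)) (suc s) σ out ⊎ (s ≡ j × Correct (suc (s + j)) (suc s) σ (reversed out))

module Correctness {n : ℕ} (x₀ : Fin n) (s j : ℕ) (σ : Order n) where

  open Algorithm x₀ s j

  Run : {A : Set} → Prog A → A → ℕ → Set
  Run = Runs (suc s) σ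

  r : Fin n → ℕ
  r = rank σ

  r-injective : ∀ {x y} → r x ≡ r y → x ≡ y
  r-injective {x} {y} rx≡ry = begin
    x                          ≡⟨ inverseˡ σ ⟨
    σ ⟨$⟩ˡ (σ ⟨$⟩ʳ x)          ≡⟨ cong (σ ⟨$⟩ˡ_) (Fin.toℕ-injective rx≡ry) ⟩
    σ ⟨$⟩ˡ (σ ⟨$⟩ʳ y)          ≡⟨ inverseˡ σ ⟩
    y                          ∎
    where open ≡-Reasoning

  r<n : ∀ x → r x < n
  r<n x = Fin.toℕ<n (σ ⟨$⟩ʳ x)

  r-surjective : ∀ {v} → v < n → ∃[ x ] r x ≡ v
  r-surjective v<n =
    σ ⟨$⟩ˡ Fin.fromℕ< v<n , trans (cong Fin.toℕ (inverseʳ σ)) (Fin.toℕ-fromℕ< v<n)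

  Unique⇒length≤-ranks : ∀ {lo hi xs} → Unique xs → All (λ x → lo ≤ r x × r x < hi) xs →
                         length xs ≤ hi ∸ lo
  Unique⇒length≤-ranks {xs = xs} u bounds = subst (_≤ _) (length-map r xs)
    (Unique⇒length≤-interval (Unique.map⁺ r-injective u) (All.map⁺ bounds))

  below? : (a : Fin n) → Decidable (λ y → r y < r a)
  below? a y = r y <? r a

  Small Large Middle : Fin n → Set
  Small x = r x < s
  Large x = n ≤ r x + j
  Middle x = s ≤ r x × r x + j < n

  small? : Decidable Small
  small? x = r x <? s

  record Answer (qs : List (Fin n)) (a : Fin n) : Set where
    field
      member : a ∈ qs
      countBelow : count (below? a) qs ≡ s
      middle : Middle a

  answer-middle : ∀ {qs a} → Unique qs → length qs ≡ k → a ∈ qs → count (below? a) qs ≡ s →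
                  Middle a
  answer-middle {qs} {a} u |qs|≡k a∈qs countBelow = s≤ra , ra+j<n
    where
    s≤ra : s ≤ r a
    s≤ra = subst (_≤ r a) countBelow
             (Unique⇒length≤-ranks (Unique.filter⁺ (below? a) u)
               (All.tabulate λ x∈ → z≤n , proj₂ (∈-filter⁻ (below? a) {xs = qs} x∈)))
    countAbove : count (∁? (below? a)) qs ≡ suc j
    countAbove = +-cancelˡ-≡ s _ _ (begin
      s + count (∁? (below? a)) qs
        ≡⟨ cong (_+ count (∁? (below? a)) qs) countBelow ⟨
      count (below? a) qs + count (∁? (below? a)) qs
        ≡⟨ count+count-∁ (below? a) qs ⟩
      length qs                                       ≡⟨ |qs|≡k ⟩
      suc (s + j)                                     ≡⟨ +-suc s j ⟨
      s + suc j                                       ∎)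
      where open ≡-Reasoning
    ra+j<n : r a + j < n
    ra+j<n = subst₂ _≤_ (+-suc (r a) j) (m+[n∸m]≡n (<⇒≤ (r<n a)))
               (+-monoʳ-≤ (r a) (subst (_≤ n ∸ r a) countAbove
                 (Unique⇒length≤-ranks (Unique.filter⁺ (∁? (below? a)) u)
                   (All.tabulate λ x∈ →
                     ≮⇒≥ (proj₂ (∈-filter⁻ (∁? (below? a)) {xs = qs} x∈)) , r<n _))))

  ask-correct : ∀ {qs a m} → Unique qs → length qs ≡ k → Run (ask qs) a m → m ≡ 1 × Answer qs a
  ask-correct {qs} u |qs|≡k run with ∣ toSubset qs ∣ ≟ k
  ask-correct {qs} u |qs|≡k (qry (a∈ , ∣below∣≡s) ret) | yes _ =
    refl ,
    record { member = a∈qs ; countBelow = countBelow ; middle = answer-middle u |qs|≡k a∈qs countBelow }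
    where
    a∈qs = ∈toSubset⇒∈ a∈
    countBelow = trans (sym (∣toSubset∩∣≡count (below? _) u)) ∣below∣≡s
  ... | no ∣qs∣≢k = contradiction (trans (∣toSubset∣≡length u) |qs|≡k) ∣qs∣≢k

  eliminate-correct : ∀ pool rest {P E m} → length pool ≡ k → Unique (pool ++ rest) →
                      Run (eliminate pool rest) (P , E) m →
                      P ++ E ↭ pool ++ rest × All Middle E × length P ≡ s + j × m ≡ suc (length rest)
  eliminate-correct pool [] |pool|≡k u run with Runs->>=⁻ (ask pool) run
  ... | a , _ , _ , run₁ , ret , refl with ask-correct (Unique-++⁻ˡ pool u) |pool|≡k run₁
  ... | refl , ans = perm , Answer.middle ans ∷ [] , |pool-a| , refl
    where
    open PermutationReasoning
    a∈pool = Answer.member ans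
    |pool-a| = suc-injective (trans (sym (length-remove Fin._≟_ a∈pool)) |pool|≡k)
    perm = begin
      remove Fin._≟_ a pool ++ a ∷ [] ↭⟨ ++-comm (remove Fin._≟_ a pool) (a ∷ []) ⟩
      a ∷ remove Fin._≟_ a pool       ↭⟨ ↭-remove Fin._≟_ pool a∈pool ⟨
      pool                            ≡⟨ ++-identityʳ pool ⟨
      pool ++ []                      ∎
  eliminate-correct pool (x ∷ rest) |pool|≡k u run with Runs->>=⁻ (ask pool) run
  ... | a , _ , _ , run₁ , run₂ , refl with ask-correct (Unique-++⁻ˡ pool u) |pool|≡k run₁
  ... | refl , ans
      with ↭-refill Fin._≟_ {x = x} {rest} pool (Answer.member ans)
         | Runs-<$>⁻ (eliminate (x ∷ remove Fin._≟_ a pool) rest) run₂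
  ... | refill | (P , E) , run₃ , refl
      with eliminate-correct (x ∷ remove Fin._≟_ a pool) rest
             (trans (sym (length-remove Fin._≟_ (Answer.member ans))) |pool|≡k)
             (AllPairs.tail (Unique-resp-↭ refill u)) run₃
  ... | perm , middles , |P| , refl = perm' , Answer.middle ans ∷ middles , |P| , refl
    where
    open PermutationReasoning
    perm' = begin
      P ++ a ∷ E                                 ↭⟨ shift a P E ⟩
      a ∷ P ++ E                                 ↭⟨ prep a perm ⟩
      a ∷ (x ∷ remove Fin._≟_ a pool) ++ rest    ↭⟨ refill ⟨
      pool ++ x ∷ rest                           ∎

  module MergeSort (q : List (Fin n) → List (Fin n)) (key : Fin n → ℕ)
                   (key-injective : ∀ {x y} → key x ≡ key y → x ≡ y) (E₀ : List (Fin n))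
                   (oracle : ∀ {W a c} → 0 < length W → length W ≤ suc j → W ⊆ E₀ → Unique W →
                             Run (ask (q W)) a c → c ≡ 1 × a ∈ W × All (λ w → key a ≤ key w) W)
                   where

    Increasing : List (Fin n) → Set
    Increasing = AllPairs (λ x y → key x < key y)

    merge-correct : ∀ size xss {ys c} → length (concat xss) ≡ size → All Increasing xss →
                    Unique (concat xss) → concat xss ⊆ E₀ → length xss ≤ suc j →
                    Run (merge q size xss) ys c → Increasing ys × ys ↭ concat xss × c ≡ size
    merge-correct zero xss |xss|≡0 _ _ _ _ ret with concat xss
    ... | [] = [] , ↭-refl , refl
    merge-correct (suc size) xss |xss|≡ ↑xss u ⊆E₀ |xss|≤ run
      with Runs->>=⁻ (ask (q (heads xss))) run
    ... | a , _ , _ , run₁ , run₂ , refl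
      with oracle (heads-nonempty xss (subst (0 <_) (sym |xss|≡) (s≤s z≤n)))
                  (≤-trans (length-heads≤ xss) |xss|≤) (⊆E₀ ∘ heads⊆concat xss)
                  (Unique-heads xss u) run₁
    ... | refl , a∈heads , a≤heads
      with ↭-popHead Fin._≟_ xss a∈heads | Runs-<$>⁻ (merge q size (popHead Fin._≟_ a xss)) run₂
    ... | xss↭ | ys , run₃ , refl
      with merge-correct size (popHead Fin._≟_ a xss)
             (suc-injective (trans (sym (↭-length xss↭)) |xss|≡)) (popHead⁺ Fin._≟_ a ↑xss)
             (AllPairs.tail (Unique-resp-↭ xss↭ u)) (⊆E₀ ∘ ∈-resp-↭ (↭-sym xss↭) ∘ there)
             (subst (_≤ suc j) (sym (length-popHead Fin._≟_ a xss)) |xss|≤) run₃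
    ... | ↑ys , ys↭ , refl = All.tabulate a<y ∷ ↑ys , ↭-trans (prep a ys↭) (↭-sym xss↭) , refl
      where
      a<y : ∀ {y} → y ∈ ys → key a < key y
      a<y y∈ys = ≤∧≢⇒< (All.lookup (heads-lower-bound key xss ↑xss a≤heads) y∈xss)
                        (All.lookup (AllPairs.head (Unique-resp-↭ xss↭ u)) y∈ ∘ key-injective)
        where
        y∈ = ∈-resp-↭ ys↭ y∈ys
        y∈xss = ∈-resp-↭ (↭-sym xss↭) (there y∈)

    sort-correct : ∀ d xs {ys c} → length xs ≤ suc j ^ d → Unique xs → xs ⊆ E₀ →
                   Run (sort q d xs) ys c → Increasing ys × ys ↭ xs × c ≤ d * length xs
    sortAll-correct : ∀ d xss {yss c} → All (λ xs → length xs ≤ suc j ^ d) xss →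
                      Unique (concat xss) → concat xss ⊆ E₀ → Run (mapM (sort q d) xss) yss c →
                      All Increasing yss × concat yss ↭ concat xss × length yss ≡ length xss ×
                      c ≤ d * length (concat xss)

    sort-correct zero [] _ _ _ ret = [] , ↭-refl , z≤n
    sort-correct zero (x ∷ []) _ _ _ ret = [] ∷ [] , ↭-refl , z≤n
    sort-correct zero (_ ∷ _ ∷ _) (s≤s ()) _ _ _
    sort-correct (suc d) xs |xs|≤ u ⊆E₀ run
      with concat-chunks (suc j) (suc j ^ d) xs |xs|≤
         | Runs->>=⁻ (mapM (sort q d) (chunks (suc j) (suc j ^ d) xs)) run
    ... | concat≡xs | yss , c₁ , _ , run₁ , run₂ , refl
      with sortAll-correct d (chunks (suc j) (suc j ^ d) xs) (chunks-bounded (suc j) (suc j ^ d) xs)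
             (subst Unique (sym concat≡xs) u) (⊆E₀ ∘ subst (_ ∈_) concat≡xs) run₁
    ... | ↑yss , yss↭ , |yss| , c₁≤ with subst (concat yss ↭_) concat≡xs yss↭
    ... | yss↭xs
      with merge-correct (length xs) yss (↭-length yss↭xs) ↑yss (Unique-resp-↭ (↭-sym yss↭xs) u)
             (⊆E₀ ∘ ∈-resp-↭ yss↭xs)
             (≤-reflexive (trans |yss| (length-chunks (suc j) (suc j ^ d) xs))) run₂
    ... | ↑ys , ys↭ , refl = ↑ys , ↭-trans ys↭ yss↭xs , cost
      where
      cost : c₁ + length xs ≤ suc d * length xs
      cost = subst (c₁ + length xs ≤_) (+-comm (d * length xs) (length xs))
               (+-monoˡ-≤ (length xs) (subst (λ zs → c₁ ≤ d * length zs) concat≡xs c₁≤))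

    sortAll-correct d [] _ _ _ ret = [] , ↭-refl , refl , z≤n
    sortAll-correct d (xs ∷ xss) (|xs|≤ ∷ bounded) u ⊆E₀ run with Runs->>=⁻ (sort q d xs) run
    ... | ys , c₁ , c₂ , run₁ , run₂ , refl with Runs-<$>⁻ (mapM (sort q d) xss) run₂
    ... | yss , run₃ , refl
      with sort-correct d xs |xs|≤ (Unique-++⁻ˡ xs u) (⊆E₀ ∘ ∈-++⁺ˡ) run₁
         | sortAll-correct d xss bounded (Unique-++⁻ʳ xs u) (⊆E₀ ∘ ∈-++⁺ʳ xs) run₃
    ... | ↑ys , ys↭ , c₁≤ | ↑yss , yss↭ , |yss| , c₂≤ =
      ↑ys ∷ ↑yss , ++⁺ ys↭ yss↭ , cong suc |yss| , cost
      where
      cost : c₁ + c₂ ≤ d * length (xs ++ concat xss)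
      cost = subst (c₁ + c₂ ≤_)
                   (trans (sym (*-distribˡ-+ d (length xs) _)) (cong (d *_) (sym (length-++ xs))))
                   (+-mono-≤ c₁≤ c₂≤)

  record Separation (P E : List (Fin n)) : Set where
    field
      ↭allFin : P ++ E ↭ allFin n
      middles : All Middle E
      |P| : length P ≡ s + j

  module Separated {P E : List (Fin n)} (sep : Separation P E) where

    open Separation sep

    unique : Unique (P ++ E)
    unique = Unique-resp-↭ (↭-sym ↭allFin) (Unique.allFin⁺ n)

    unique-P : Unique P
    unique-P = Unique-++⁻ˡ P unique

    unique-E : Unique E
    unique-E = Unique-++⁻ʳ P unique

    |P|+|E|≡n : s + j + length E ≡ n
    |P|+|E|≡n = begin
      s + j + length E      ≡⟨ cong (_+ length E) |P| ⟨
      length P + length E   ≡⟨ length-++ P ⟨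
      length (P ++ E)       ≡⟨ ↭-length ↭allFin ⟩
      length (allFin n)     ≡⟨ length-tabulate id ⟩
      n                     ∎
      where open ≡-Reasoning

    |E| : length E ≡ n ∸ (s + j)
    |E| = trans (sym (m+n∸m≡n (s + j) (length E))) (cong (_∸ (s + j)) |P|+|E|≡n)

    s+j≤n : s + j ≤ n
    s+j≤n = subst (s + j ≤_) |P|+|E|≡n (m≤m+n (s + j) (length E))

    ∈P⊎∈E : ∀ x → x ∈ P ⊎ x ∈ E
    ∈P⊎∈E x = ∈-++⁻ P (∈-resp-↭ (↭-sym ↭allFin) (∈-allFin x))

    -- E already takes up all n ∸ (s + j) middle ranks
    P-not-middle : ∀ {x} → x ∈ P → ¬ Middle x
    P-not-middle {x} x∈P middle-x = <-irrefl refl (begin-strict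
      length E                 <⟨ n<1+n (length E) ⟩
      length (x ∷ E)           ≤⟨ Unique⇒length≤-ranks (x∉E ∷ unique-E)
                                    (All.map bounds (middle-x ∷ middles)) ⟩
      n ∸ j ∸ s                ≡⟨ ∸-+-assoc n j s ⟩
      n ∸ (j + s)              ≡⟨ cong (n ∸_) (+-comm j s) ⟩
      n ∸ (s + j)              ≡⟨ |E| ⟨
      length E                 ∎)
      where
      open ≤-Reasoning
      x∉E : All (x ≢_) E
      x∉E = All.tabulate λ y∈E x≡y →
              Unique-++⇒disjoint P unique x∈P (subst (_∈ E) (sym x≡y) y∈E)
      bounds : ∀ {y} → Middle y → s ≤ r y × r y < n ∸ j
      bounds (s≤ry , ry+j<n) = s≤ry , m+n≤o⇒m≤o∸n (suc (r _)) ry+j<n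

    small⊎large : ∀ {x} → x ∈ P → Small x ⊎ Large x
    small⊎large {x} x∈P with small? x | r x + j <? n
    ... | yes small | _ = inj₁ small
    ... | no ¬small | yes ¬large = contradiction (≮⇒≥ ¬small , ¬large) (P-not-middle x∈P)
    ... | no _ | no ¬¬large = inj₂ (≮⇒≥ ¬¬large)

    small⇒∈P : ∀ {x} → Small x → x ∈ P
    small⇒∈P {x} small with ∈P⊎∈E x
    ... | inj₁ x∈P = x∈P
    ... | inj₂ x∈E = contradiction small (≤⇒≯ (proj₁ (All.lookup middles x∈E)))

    large⇒∈P : ∀ {x} → Large x → x ∈ P
    large⇒∈P {x} large with ∈P⊎∈E x
    ... | inj₁ x∈P = x∈P
    ... | inj₂ x∈E = contradiction large (<⇒≱ (proj₂ (All.lookup middles x∈E)))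

    below⇔small : ∀ {a y} → Middle a → y ∈ P → (r y < r a ⇔ Small y)
    below⇔small {a} {y} (s≤ra , ra+j<n) y∈P = mk⇔ to (λ small → <-≤-trans small s≤ra)
      where
      to : r y < r a → Small y
      to ry<ra with small⊎large y∈P
      ... | inj₁ small = small
      ... | inj₂ large = contradiction (+-monoˡ-< j ry<ra) (<-asym (<-≤-trans ra+j<n large))

    count-small : count small? P ≡ s
    count-small = ≤-antisym
      (Unique⇒length≤-ranks (Unique.filter⁺ small? unique-P)
        (All.tabulate λ x∈ → z≤n , proj₂ (∈-filter⁻ small? {xs = P} x∈)))
      (begin
        s                             ≡⟨ length-upTo s ⟨
        length (upTo s)               ≤⟨ Unique⇒length≤ (Unique.upTo⁺ s) upTo⊆ ⟩
        length (map r (filter small? P)) ≡⟨ length-map r (filter small? P) ⟩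
        count small? P                ∎)
      where
      open ≤-Reasoning
      upTo⊆ : upTo s ⊆ map r (filter small? P)
      upTo⊆ v∈ with r-surjective (<-≤-trans (∈-upTo⁻ v∈) (≤-trans (m≤m+n s j) s+j≤n))
      ... | x , refl = ∈-map⁺ r (∈-filter⁺ small? (small⇒∈P (∈-upTo⁻ v∈)) (∈-upTo⁻ v∈))

    -- Removing p from P leaves the count below a middle element a equal to the number of small
    -- elements other than p, so whether b counts below a tells whether p is small.
    pivot : ∀ {p a b} → p ∈ P → Middle a →
            count (below? a) (remove Fin._≟_ p P ++ a ∷ b ∷ []) ≡ s → Small p ⇔ r b < r a
    pivot {p} {a} {b} p∈P middle-a countBelow =
      count-singleton⇒⇔ small? (below? a) (+-cancelʳ-≡ _ _ _ (begin
      count small? (p ∷ []) + count small? R          ≡⟨ count-++ small? (p ∷ []) R ⟨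
      count small? (p ∷ R)                            ≡⟨ count-↭ small? P↭ ⟨
      count small? P                                  ≡⟨ count-small ⟩
      s                                               ≡⟨ countBelow ⟨
      count (below? a) (R ++ a ∷ b ∷ [])              ≡⟨ count-++ (below? a) R (a ∷ b ∷ []) ⟩
      count (below? a) R + count (below? a) (a ∷ b ∷ []) ≡⟨ cong₂ _+_ R-below≡small a-not-below ⟩
      count small? R + count (below? a) (b ∷ [])      ≡⟨ +-comm (count small? R) _ ⟩
      count (below? a) (b ∷ []) + count small? R      ∎))
      where
      open ≡-Reasoning
      R = remove Fin._≟_ p P
      P↭ = ↭-remove Fin._≟_ P p∈P
      R-below≡small : count (below? a) R ≡ count small? R
      R-below≡small = count-cong (below? a) small?
        (All.tabulate λ y∈R → below⇔small middle-a (∈-resp-↭ (↭-sym P↭) (there y∈R)))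
      a-not-below : count (below? a) (a ∷ b ∷ []) ≡ count (below? a) (b ∷ [])
      a-not-below = cong length (filter-reject (below? a) (<-irrefl refl))

    classify-answer : ∀ {p m m' a} → p ∈ P → Answer (remove Fin._≟_ p P ++ m ∷ m' ∷ []) a →
                      (a ≡ m × (Small p ⇔ r m' < r m)) ⊎ (a ≡ m' × (Small p ⇔ r m < r m'))
    classify-answer {p} {m} {m'} p∈P ans with ∈-++⁻ (remove Fin._≟_ p P) (Answer.member ans)
    ... | inj₁ a∈R = contradiction (Answer.middle ans)
                       (P-not-middle (∈-resp-↭ (↭-sym (↭-remove Fin._≟_ P p∈P)) (there a∈R)))
    ... | inj₂ (here refl) = inj₁ (refl , pivot p∈P (Answer.middle ans) (Answer.countBelow ans))
    ... | inj₂ (there (here refl)) = inj₂ (refl , pivot p∈P (Answer.middle ans)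
            (trans (count-↭ (below? m') (++⁺ˡ (remove Fin._≟_ p P) (swap m' m ↭-refl)))
                   (Answer.countBelow ans)))

    classify-correct : ∀ {m m'} → m ∈ E → m' ∈ E → m ≢ m' → ∀ ps {A B c} → ps ⊆ P →
                       Run (classify P m m' ps) (A , B) c →
                       A ++ B ↭ ps × All (λ p → Small p ⇔ r m' < r m) A ×
                       All (λ p → Small p ⇔ r m < r m') B × c ≡ length ps
    classify-correct m∈E m'∈E m≢m' [] _ ret = ↭-refl , [] , [] , refl
    classify-correct {m} {m'} m∈E m'∈E m≢m' (p ∷ ps) ps⊆P run
      with Runs->>=⁻ (ask (remove Fin._≟_ p P ++ m ∷ m' ∷ [])) run
    ... | a , _ , _ , run₁ , run₂ , refl with ask-correct unique-query |query| run₁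
      where
      p∈P = ps⊆P (here refl)
      R⊆P : remove Fin._≟_ p P ⊆ P
      R⊆P y∈R = ∈-resp-↭ (↭-sym (↭-remove Fin._≟_ P p∈P)) (there y∈R)
      unique-query : Unique (remove Fin._≟_ p P ++ m ∷ m' ∷ [])
      unique-query = Unique.++⁺ (AllPairs.tail (Unique-resp-↭ (↭-remove Fin._≟_ P p∈P) unique-P))
        ((m≢m' ∷ []) ∷ [] ∷ [])
        λ { (y∈R , here refl) → Unique-++⇒disjoint P unique (R⊆P y∈R) m∈E
          ; (y∈R , there (here refl)) → Unique-++⇒disjoint P unique (R⊆P y∈R) m'∈E }
      |query| : length (remove Fin._≟_ p P ++ m ∷ m' ∷ []) ≡ k
      |query| = begin
        length (remove Fin._≟_ p P ++ m ∷ m' ∷ []) ≡⟨ length-++ (remove Fin._≟_ p P) ⟩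
        length (remove Fin._≟_ p P) + 2            ≡⟨ +-comm _ 2 ⟩
        suc (suc (length (remove Fin._≟_ p P)))    ≡⟨ cong suc (length-remove Fin._≟_ p∈P) ⟨
        suc (length P)                             ≡⟨ cong suc |P| ⟩
        k                                          ∎
        where open ≡-Reasoning
    ... | refl , ans with Runs-<$>⁻ (classify P m m' ps) run₂
    ... | (A , B) , run₃ , refl with classify-correct m∈E m'∈E m≢m' ps (ps⊆P ∘ there) run₃
    ... | A++B↭ps , allA , allB , refl with a Fin.≟ m | classify-answer (ps⊆P (here refl)) ans
    ... | yes refl | inj₁ (_ , small⇔) = prep p A++B↭ps , small⇔ ∷ allA , allB , refl
    ... | yes refl | inj₂ (m≡m' , _) = contradiction m≡m' m≢m'
    ... | no a≢m | inj₁ (a≡m , _) = contradiction a≡m a≢m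
    ... | no _ | inj₂ (refl , small⇔) =
      ↭-trans (shift p A B) (prep p A++B↭ps) , allA , small⇔ ∷ allB , refl

    record Split (S L : List (Fin n)) : Set where
      field
        ↭P : S ++ L ↭ P
        smalls : All Small S
        notSmalls : All (∁ Small) L

    module Splitting {S L : List (Fin n)} (split : Split S L) where

      open Split split

      L⊆P : L ⊆ P
      L⊆P = ∈-resp-↭ ↭P ∘ ∈-++⁺ʳ S

      |S| : length S ≡ s
      |S| = begin
        length S                                ≡⟨ count-all small? smalls ⟨
        count small? S                          ≡⟨ +-identityʳ _ ⟨
        count small? S + 0                      ≡⟨ cong (_ +_) (count-none small? notSmalls) ⟨
        count small? S + count small? L         ≡⟨ count-++ small? S L ⟨
        count small? (S ++ L)                   ≡⟨ count-↭ small? ↭P ⟩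
        count small? P                          ≡⟨ count-small ⟩
        s                                       ∎
        where open ≡-Reasoning

      |L| : length L ≡ j
      |L| = +-cancelˡ-≡ s _ _ (begin
        s + length L          ≡⟨ cong (_+ length L) |S| ⟨
        length S + length L   ≡⟨ length-++ S ⟨
        length (S ++ L)       ≡⟨ ↭-length ↭P ⟩
        length P              ≡⟨ |P| ⟩
        s + j                 ∎)
        where open ≡-Reasoning

    split-by : ∀ {m m' A B} → r m' < r m → A ++ B ↭ P →
               All (λ p → Small p ⇔ r m' < r m) A → All (λ p → Small p ⇔ r m < r m') B → Split A B
    split-by m'<m A++B↭P allA allB = record
      { ↭P = A++B↭P
      ; smalls = All.map (λ small⇔ → Equivalence.from small⇔ m'<m) allA
      ; notSmalls = All.map (λ small⇔ small → <-asym m'<m (Equivalence.to small⇔ small)) allB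
      }

    classification-splits : ∀ {m m' A B} → m ≢ m' → A ++ B ↭ P →
                            All (λ p → Small p ⇔ r m' < r m) A → All (λ p → Small p ⇔ r m < r m') B →
                            Split A B ⊎ Split B A
    classification-splits {m} {m'} {A} {B} m≢m' A++B↭P allA allB with <-cmp (r m') (r m)
    ... | tri< m'<m _ _ = inj₁ (split-by m'<m A++B↭P allA allB)
    ... | tri≈ _ rm'≡rm _ = contradiction (r-injective (sym rm'≡rm)) m≢m'
    ... | tri> _ _ m<m' = inj₂ (split-by m<m' (↭-trans (++-comm B A) A++B↭P) allB allA)

    orient-correct : ∀ {A B} → Split A B ⊎ Split B A →
                     let (S , L) = orient (A , B) in Split S L ⊎ (s ≡ j × Split L S)
    orient-correct {A} (inj₁ split) with length A ≟ s
    ... | yes _ = inj₁ split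
    ... | no |A|≢s = contradiction (Splitting.|S| split) |A|≢s
    orient-correct {A} (inj₂ split) with length A ≟ s
    ... | yes |A|≡s = inj₂ (trans (sym |A|≡s) (Splitting.|L| split) , split)
    ... | no _ = inj₁ split

    -- U and V are S and L, in this order or, when s = j, swapped
    module _ {U V W : List (Fin n)} (U++V↭P : U ++ V ↭ P) (|U| : length U ≡ s) (|V| : length V ≡ j)
             (0<|W| : 0 < length W) (|W|≤ : length W ≤ suc j) (W⊆E : W ⊆ E) (unique-W : Unique W) where

      private
        T = take (suc j ∸ length W) V
        U⊆P : U ⊆ P
        U⊆P = ∈-resp-↭ U++V↭P ∘ ∈-++⁺ˡ
        T⊆V : T ⊆ V
        T⊆V = subst (_ ∈_) (take++drop≡id (suc j ∸ length W) V) ∘ ∈-++⁺ˡ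
        T⊆P : T ⊆ P
        T⊆P = ∈-resp-↭ U++V↭P ∘ ∈-++⁺ʳ U ∘ T⊆V
        unique-UV : Unique (U ++ V)
        unique-UV = Unique-resp-↭ (↭-sym U++V↭P) unique-P
        P∌E : ∀ {x} → x ∈ P → x ∈ E → ⊥
        P∌E = Unique-++⇒disjoint P unique
        |T| : length T ≡ suc j ∸ length W
        |T| = trans (length-take (suc j ∸ length W) V)
                    (m≤n⇒m⊓n≡m (subst (suc j ∸ length W ≤_) (sym |V|) (∸-monoʳ-≤ (suc j) 0<|W|)))

      minQuery-answer : ∀ {a c} → Run (ask (minQuery U V W)) a c →
                        c ≡ 1 × a ∈ W × Middle a ×
                        count (below? a) U + (count (below? a) W + count (below? a) T) ≡ s
      minQuery-answer {a} run with ask-correct unique-query |query| run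
        where
        unique-query : Unique (minQuery U V W)
        unique-query = Unique.++⁺ (Unique-++⁻ˡ U unique-UV)
          (Unique.++⁺ unique-W (Unique.take⁺ _ (Unique-++⁻ʳ U unique-UV))
            λ (x∈W , x∈T) → P∌E (T⊆P x∈T) (W⊆E x∈W))
          λ (x∈U , x∈W++T) → [ (λ x∈W → P∌E (U⊆P x∈U) (W⊆E x∈W))
                             , (λ x∈T → Unique-++⇒disjoint U unique-UV x∈U (T⊆V x∈T))
                             ] (∈-++⁻ W x∈W++T)
        |query| : length (minQuery U V W) ≡ k
        |query| = begin
          length (U ++ W ++ T)                 ≡⟨ length-++ U ⟩
          length U + length (W ++ T)           ≡⟨ cong₂ _+_ |U| (length-++ W) ⟩
          s + (length W + length T)            ≡⟨ cong (λ x → s + (length W + x)) |T| ⟩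
          s + (length W + (suc j ∸ length W))  ≡⟨ cong (s +_) (m+[n∸m]≡n |W|≤) ⟩
          s + suc j                            ≡⟨ +-suc s j ⟩
          k                                    ∎
          where open ≡-Reasoning
      ... | refl , ans = refl , a∈W , Answer.middle ans ,
            trans (cong (count (below? a) U +_) (sym (count-++ (below? a) W T)))
                  (trans (sym (count-++ (below? a) U (W ++ T))) (Answer.countBelow ans))
        where
        a∈W : a ∈ W
        a∈W with ∈-++⁻ U (Answer.member ans)
        ... | inj₁ a∈U = contradiction (Answer.middle ans) (P-not-middle (U⊆P a∈U))
        ... | inj₂ a∈W++T with ∈-++⁻ W a∈W++T
        ...   | inj₁ a∈W = a∈W
        ...   | inj₂ a∈T = contradiction (Answer.middle ans) (P-not-middle (T⊆P a∈T))

      minQuery-min : All Small U → All (∁ Small) V → ∀ {a c} → Run (ask (minQuery U V W)) a c →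
                     c ≡ 1 × a ∈ W × All (λ w → r a ≤ r w) W
      minQuery-min smalls notSmalls {a} run with minQuery-answer run
      ... | c≡1 , a∈W , middle-a , counts =
        c≡1 , a∈W , All.map ≮⇒≥ (count≡0⇒none (below? a) W count-W≡0)
        where
        count-U : count (below? a) U ≡ s
        count-U = trans (count-all (below? a) (All.tabulate λ x∈U →
                    Equivalence.from (below⇔small middle-a (U⊆P x∈U)) (All.lookup smalls x∈U))) |U|
        count-T : count (below? a) T ≡ 0
        count-T = count-none (below? a) (All.tabulate λ x∈T →
                    All.lookup notSmalls (T⊆V x∈T) ∘
                    Equivalence.to (below⇔small middle-a (T⊆P x∈T)))
        count-W≡0 : count (below? a) W ≡ 0
        count-W≡0 = +-cancelˡ-≡ s _ _ (begin
          s + count (below? a) W                          ≡⟨ +-identityʳ _ ⟨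
          s + count (below? a) W + 0                      ≡⟨ +-assoc s _ 0 ⟩
          s + (count (below? a) W + 0)                    ≡⟨ cong₂ (λ x y → x + (_ + y)) count-U count-T ⟨
          count (below? a) U + (count (below? a) W + count (below? a) T) ≡⟨ counts ⟩
          s                                               ≡⟨ +-identityʳ s ⟨
          s + 0                                           ∎)
          where open ≡-Reasoning

      minQuery-max : All (∁ Small) U → All Small V → s ≡ j → ∀ {a c} →
                     Run (ask (minQuery U V W)) a c → c ≡ 1 × a ∈ W × All (λ w → r w ≤ r a) W
      minQuery-max notSmalls smalls s≡j {a} run with minQuery-answer run
      ... | c≡1 , a∈W , middle-a , counts = c≡1 , a∈W , All.tabulate w≤a
        where
        count-U : count (below? a) U ≡ 0
        count-U = count-none (below? a) (All.tabulate λ x∈U →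
                    All.lookup notSmalls x∈U ∘ Equivalence.to (below⇔small middle-a (U⊆P x∈U)))
        count-T : count (below? a) T ≡ suc j ∸ length W
        count-T = trans (count-all (below? a) (All.tabulate λ x∈T →
                    Equivalence.from (below⇔small middle-a (T⊆P x∈T)) (All.lookup smalls (T⊆V x∈T))))
                  |T|
        count-W : suc (count (below? a) W) ≡ length W
        count-W = +-cancelʳ-≡ (suc j ∸ length W) _ _ (begin
          suc (count (below? a) W) + (suc j ∸ length W)  ≡⟨ cong (λ x → suc (_ + x)) count-T ⟨
          suc (count (below? a) W + count (below? a) T)
            ≡⟨ cong (λ x → suc (x + (count (below? a) W + count (below? a) T))) count-U ⟨
          suc (count (below? a) U + (count (below? a) W + count (below? a) T)) ≡⟨ cong suc counts ⟩
          suc s                                          ≡⟨ cong suc s≡j ⟩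
          suc j                                          ≡⟨ m+[n∸m]≡n |W|≤ ⟨
          length W + (suc j ∸ length W)                  ∎)
          where open ≡-Reasoning
        w≤a : ∀ {w} → w ∈ W → r w ≤ r a
        w≤a {w} w∈W with w Fin.≟ a
        ... | yes refl = ≤-refl
        ... | no w≢a = <⇒≤ (count≡length-1⇒ (below? a) a∈W (<-irrefl refl) count-W w∈W w≢a)

    module Output {S L : List (Fin n)} (split : Split S L) where

      open Split split
      open Splitting split

      ∈S⇔small : ∀ x → x ∈ S ⇔ Small x
      ∈S⇔small x = mk⇔ (All.lookup smalls) λ small →
        [ id , (λ x∈L → contradiction small (All.lookup notSmalls x∈L)) ]
          (∈-++⁻ S (∈-resp-↭ (↭-sym ↭P) (small⇒∈P small)))

      ∈L⇔large : ∀ x → x ∈ L ⇔ Large x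
      ∈L⇔large x = mk⇔ to λ large →
        [ (λ x∈S → contradiction (+-monoˡ-< j (All.lookup smalls x∈S)) (≤⇒≯ (≤-trans s+j≤n large)))
        , id
        ]
          (∈-++⁻ S (∈-resp-↭ (↭-sym ↭P) (large⇒∈P large)))
        where
        to : x ∈ L → Large x
        to x∈L =
          [ (λ small → contradiction small (All.lookup notSmalls x∈L)) , id ] (small⊎large (L⊆P x∈L))

      toSubset-S : toSubset S ≡ smallSet (suc s) σ
      toSubset-S = toSubset-cong small? ∈S⇔small

      toSubset-L : toSubset L ≡ largeSet k (suc s) σ
      toSubset-L = toSubset-cong (λ x → n ∸ (k ∸ suc s) ≤? r x) large⇔
        where
        large⇔ : ∀ x → x ∈ L ⇔ n ∸ (k ∸ suc s) ≤ r x
        large⇔ x = subst (λ i → x ∈ L ⇔ n ∸ i ≤ r x) (sym (m+n∸m≡n s j)) (mk⇔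
          (λ x∈L → m≤n+o⇒m∸n≤o n j (subst (n ≤_) (+-comm (r x) j) (Equivalence.to (∈L⇔large x) x∈L)))
          (λ n-j≤rx → Equivalence.from (∈L⇔large x)
            (≤-trans (m≤n+m∸n n j) (subst (_≤ r x + j) (+-comm (n ∸ j) j) (+-monoˡ-≤ j n-j≤rx)))))

    increasing-middles : ∀ {M} → M ↭ E → AllPairs (λ x y → r x < r y) M →
                         IsMiddleOrder k (suc s) σ M
    increasing-middles {M} M↭E ↑M = trans
      (increasing-interval⇒≡applyUpTo (n ∸ (s + j)) s (AllPairs.map⁺ ↑M)
        (All.map⁺ (All.tabulate (bounds ∘ All.lookup middles ∘ ∈-resp-↭ M↭E)))
        (trans (length-map r M) (trans (↭-length M↭E) |E|)))
      (sym (map-upTo (s +_) (n ∸ (s + j))))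
      where
      bounds : ∀ {x} → Middle x → s ≤ r x × r x < s + (n ∸ (s + j))
      bounds {x} (s≤rx , rx+j<n) = s≤rx , +-cancelʳ-< j (r x) _ (begin-strict
        r x + j                   <⟨ rx+j<n ⟩
        n                         ≡⟨ |P|+|E|≡n ⟨
        s + j + length E          ≡⟨ cong (s + j +_) |E| ⟩
        s + j + (n ∸ (s + j))     ≡⟨ +-assoc s j _ ⟩
        s + (j + (n ∸ (s + j)))   ≡⟨ cong (s +_) (+-comm j _) ⟩
        s + ((n ∸ (s + j)) + j)   ≡⟨ +-assoc s _ j ⟨
        s + (n ∸ (s + j)) + j     ∎)
        where open ≤-Reasoning

    decreasing-middles : ∀ {M} → M ↭ E → AllPairs (λ x y → r y < r x) M →
                         IsMiddleOrder k (suc s) σ (reverse M)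
    decreasing-middles {M} M↭E ↓M =
      increasing-middles (↭-trans (↭-reverse M) M↭E) (AllPairs-reverse⁺ ↓M)

    sort-min : ∀ {S L} → Split S L → length E ≤ suc j ^ depth → ∀ {M c} →
               Run (sort (minQuery S L) depth E) M c →
               Correct k (suc s) σ (toSubset S , toSubset L , M) × c ≤ depth * length E
    sort-min {S} {L} split E-fits run with MergeSort.sort-correct (minQuery S L) r r-injective E oracle
                                             depth E E-fits unique-E id run
      where
      open Split split
      oracle : ∀ {W a c} → 0 < length W → length W ≤ suc j → W ⊆ E → Unique W →
               Run (ask (minQuery S L W)) a c → c ≡ 1 × a ∈ W × All (λ w → r a ≤ r w) W
      oracle {W} 0<|W| |W|≤ W⊆E uW = minQuery-min {W = W} ↭P (Splitting.|S| split) (Splitting.|L| split)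
                                       0<|W| |W|≤ W⊆E uW smalls notSmalls
    ... | ↑M , M↭E , c≤ =
      (Output.toSubset-S split , Output.toSubset-L split , increasing-middles M↭E ↑M) , c≤

    sort-max : ∀ {S L} → Split L S → s ≡ j → length E ≤ suc j ^ depth → ∀ {M c} →
               Run (sort (minQuery S L) depth E) M c →
               Correct k (suc s) σ (toSubset L , toSubset S , reverse M) × c ≤ depth * length E
    sort-max {S} {L} split s≡j E-fits run
      with MergeSort.sort-correct (minQuery S L) (λ x → n ∸ r x) key-injective E oracle
             depth E E-fits unique-E id run
      where
      open Split split
      key-injective : ∀ {x y} → n ∸ r x ≡ n ∸ r y → x ≡ y
      key-injective {x} {y} eq = r-injective (∸-cancelˡ-≡ (<⇒≤ (r<n x)) (<⇒≤ (r<n y)) eq)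
      oracle : ∀ {W a c} → 0 < length W → length W ≤ suc j → W ⊆ E → Unique W →
               Run (ask (minQuery S L W)) a c → c ≡ 1 × a ∈ W × All (λ w → n ∸ r a ≤ n ∸ r w) W
      oracle {W} 0<|W| |W|≤ W⊆E uW run
        with minQuery-max {W = W} (↭-trans (++-comm S L) ↭P) (trans (Splitting.|L| split) (sym s≡j))
               (trans (Splitting.|S| split) s≡j) 0<|W| |W|≤ W⊆E uW notSmalls smalls s≡j run
      ... | c≡1 , a∈W , w≤a = c≡1 , a∈W , All.map (∸-monoʳ-≤ n) w≤a
    ... | ↑M , M↭E , c≤ =
      (Output.toSubset-S split , Output.toSubset-L split ,
       decreasing-middles M↭E (AllPairs.map ∸-cancelʳ-< ↑M)) , c≤

    sort-solution : ∀ {S L} → Split S L ⊎ (s ≡ j × Split L S) → length E ≤ suc j ^ depth →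
                    ∀ {M c} → Run (sort (minQuery S L) depth E) M c →
                    Solution s j σ (toSubset S , toSubset L , M) × c ≤ depth * length E
    sort-solution (inj₁ split) E-fits run = Product.map₁ inj₁ (sort-min split E-fits run)
    sort-solution (inj₂ (s≡j , split)) E-fits run =
      Product.map₁ (λ correct → inj₂ (s≡j , correct)) (sort-max split s≡j E-fits run)

    splitAndSort-correct : ∀ {out c} → 2 ≤ length E → length E ≤ suc j ^ depth →
                           Run (splitAndSort (P , E)) out c →
                           ∃[ c' ] c ≡ s + j + c' × c' ≤ depth * length E × Solution s j σ out
    splitAndSort-correct = go E refl
      where
      go : ∀ E' {out c} → E' ≡ E → 2 ≤ length E → length E ≤ suc j ^ depth →
           Run (splitAndSort (P , E')) out c →
           ∃[ c' ] c ≡ s + j + c' × c' ≤ depth * length E × Solution s j σ out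
      go (m ∷ m' ∷ rest) refl _ E-fits run with Runs->>=⁻ (orient <$> classify P m m' P) run
      ... | _ , _ , _ , run₁ , run₂ , refl with Runs-<$>⁻ (classify P m m' P) run₁
      ... | (A , B) , run₃ , refl with classify-correct (here refl) (there (here refl)) m≢m' P id run₃
        where m≢m' = All.head (AllPairs.head unique-E)
      ... | A++B↭P , allA , allB , refl
        with Runs->>=⁻ (sort (minQuery (proj₁ (orient (A , B))) (proj₂ (orient (A , B)))) depth E) run₂
      ... | M , c' , _ , run₄ , ret , refl =
        c' , cong₂ _+_ |P| (+-identityʳ c') ,
        Product.swap (sort-solution (orient-correct (classification-splits m≢m' A++B↭P allA allB))
                                    E-fits run₄)
        where m≢m' = All.head (AllPairs.head unique-E)
      go [] refl () _ _
      go (_ ∷ []) refl (s≤s ()) _ _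

  eliminate-all-correct : ∀ {P E c} → k ≤ n →
                          Run (eliminate (take k (allFin n)) (drop k (allFin n))) (P , E) c →
                          Separation P E × c ≡ suc (length (drop k (allFin n)))
  eliminate-all-correct {P} {E} k≤n run
    with eliminate-correct (take k (allFin n)) (drop k (allFin n)) |take| unique-all run
    where
    |take| : length (take k (allFin n)) ≡ k
    |take| = trans (length-take k (allFin n))
                   (trans (cong (k ⊓_) (length-tabulate id)) (m≤n⇒m⊓n≡m k≤n))
    unique-all : Unique (take k (allFin n) ++ drop k (allFin n))
    unique-all = subst Unique (sym (take++drop≡id k (allFin n))) (Unique.allFin⁺ n)
  ... | P++E↭ , middles , |P| , c≡ =
    record { ↭allFin = subst (P ++ E ↭_) (take++drop≡id k (allFin n)) P++E↭
           ; middles = middles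
           ; |P| = |P|
           } ,
    c≡

  within-bound : ∀ {c'} → 1 ≤ j → suc j ≤ n' → c' ≤ depth * n' → WithinBound n k (suc s) (n + c')
  within-bound {c'} 1≤j suc-j≤n' c'≤ =
    subst₂ (λ b e → b ^ e ≤ n' ^ (2 * n')) (sym k∸s≡suc-j) (sym (m+n∸m≡n n c'))
           (b^c≤m^2m (s≤s 1≤j) suc-j≤n' c'≤)
    where
    k∸s≡suc-j : k ∸ s ≡ suc j
    k∸s≡suc-j = trans (cong (_∸ s) (sym (+-suc s j))) (m+n∸m≡n s (suc j))

  module _ (1≤j : 1 ≤ j) (n-large : s + j + suc j ≤ n) where

    k≤n : k ≤ n
    k≤n = ≤-trans (s≤s (m≤m+n (s + j) j)) (subst (_≤ n) (+-suc (s + j) j) n-large)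

    suc-j≤n' : suc j ≤ n'
    suc-j≤n' = m+n≤o⇒m≤o∸n (suc j) (subst (_≤ n) (+-comm (s + j) (suc j)) n-large)

    elimination-cost : ∀ c' → suc (length (drop k (allFin n))) + (s + j + c') ≡ n + c'
    elimination-cost c' = begin
      suc (length (drop k (allFin n))) + (s + j + c')
        ≡⟨ +-assoc (suc (length (drop k (allFin n)))) (s + j) c' ⟨
      suc (length (drop k (allFin n))) + (s + j) + c'
        ≡⟨ cong (λ x → suc x + (s + j) + c') (length-drop k (allFin n)) ⟩
      suc (length (allFin n) ∸ k) + (s + j) + c'
        ≡⟨ cong (λ x → suc (x ∸ k) + (s + j) + c') (length-tabulate {n = n} id) ⟩
      suc (n ∸ k) + (s + j) + c'
        ≡⟨ cong (_+ c') (+-suc (n ∸ k) (s + j)) ⟨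
      n ∸ k + k + c'
        ≡⟨ cong (_+ c') (m∸n+n≡m k≤n) ⟩
      n + c'
        ∎
      where open ≡-Reasoning

    algorithm-correct : ∀ {out c} → Run algorithm out c → WithinBound n k (suc s) c × Solution s j σ out
    algorithm-correct run with Runs->>=⁻ (eliminate (take k (allFin n)) (drop k (allFin n))) run
    ... | (P , E) , _ , _ , run₁ , run₂ , refl with eliminate-all-correct k≤n run₁
    ... | sep , refl with Separated.splitAndSort-correct sep 2≤|E| E-fits run₂
      where
      open Separated sep using (|E|)
      2≤|E| : 2 ≤ length E
      2≤|E| = ≤-trans (s≤s 1≤j) (subst (suc j ≤_) (sym |E|) suc-j≤n')
      E-fits : length E ≤ suc j ^ depth
      E-fits = subst (_≤ suc j ^ depth) (sym |E|)
                     (proj₁ (⌈log⌉-spec (s≤s 1≤j) (≤-trans (s≤s z≤n) suc-j≤n')))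
    ... | c' , refl , c'≤ , solution =
      subst (WithinBound n k (suc s)) (sym (elimination-cost c'))
        (within-bound 1≤j suc-j≤n' (subst (λ e → c' ≤ depth * e) (Separated.|E| sep) c'≤)) ,
      solution

Solvable : ℕ → ℕ → (∀ {n} → Order n → Output n → Set) → Set
Solvable k t Good = ∃[ N ] ∀ (n : ℕ) → N ≤ n → ∃[ A ] Solves {n} {k} t Good A

Solvable-map : ∀ {k t} {G G' : ∀ {n} → Order n → Output n → Set} →
               (∀ {n} (σ : Order n) out → G σ out → G' σ out) → Solvable k t G → Solvable k t G'
Solvable-map G⇒G' (N , solves) = N , λ n N≤n →
  Product.map₂ (λ solves σ out m run → Product.map₂ (G⇒G' σ out) (solves σ out m run)) (solves n N≤n)

algorithm-solves : ∀ s j → 1 ≤ j → Solvable (suc (s + j)) (suc s) (Solution s j)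
algorithm-solves s j 1≤j = s + j + suc j , λ n n-large →
  Algorithm.algorithm (Fin.fromℕ< (≤-trans (m≤n+m (suc j) (s + j)) n-large)) s j ,
  λ σ out m run → Correctness.algorithm-correct _ s j σ 1≤j n-large run

asymmetric-scale : ∀ k t → 2 ≤ k → 1 ≤ t → 2 * t ≤ k → Solvable k t (Correct k t)
asymmetric-scale k (suc s) _ _ 2t≤k with m≤n⇒∃[o]m+o≡n (≤-trans (m≤m+n (suc s) _) 2t≤k)
... | j , refl = Solvable-map correct (algorithm-solves s j (≤-trans (s≤s z≤n) s<j))
  where
  s<j : s < j
  s<j = +-cancelˡ-≤ (suc s) (suc s) j
          (subst (_≤ suc s + j) (cong (suc s +_) (+-identityʳ (suc s))) 2t≤k)
  correct : ∀ {n} (σ : Order n) out → Solution s j σ out → Correct (suc (s + j)) (suc s) σ out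
  correct _ _ (inj₁ c) = c
  correct _ _ (inj₂ (s≡j , _)) = contradiction s≡j (<⇒≢ s<j)

symmetric-scale : ∀ k t → 2 ≤ k → 2 * t ≡ suc k → Solvable k t (CorrectUpToReversal k t)
symmetric-scale k (suc s) 2≤k 2t≡1+k with k≡1+2s s 2t≡1+k
  where
  k≡1+2s : ∀ s → 2 * suc s ≡ suc k → suc (s + s) ≡ k
  k≡1+2s s eq = trans (cong (λ x → suc (s + x)) (sym (+-identityʳ s)))
                      (trans (sym (+-suc s (s + 0))) (suc-injective eq))
... | refl = Solvable-map upToReversal (algorithm-solves s s (positive s 2≤k))
  where
  positive : ∀ s → 2 ≤ suc (s + s) → 1 ≤ s
  positive (suc _) _ = s≤s z≤n
  positive zero (s≤s ())
  upToReversal : ∀ {n} (σ : Order n) out → Solution s s σ out →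
                 CorrectUpToReversal (suc (s + s)) (suc s) σ out
  upToReversal _ (_ , _ , _) (inj₁ correct) = inj₁ correct
  upToReversal _ (_ , _ , _) (inj₂ (_ , correct)) = inj₂ correct

mainTheorem1 : (∀ (k t : ℕ) → 2 ≤ k → 1 ≤ t → 2 * t ≤ k →
    ∃[ N ] ∀ (n : ℕ) → N ≤ n →
    ∃[ A ] Solves {n} {k} t (Correct k t) A)
    ×
    (∀ (k t : ℕ) → 2 ≤ k → 2 * t ≡ suc k →
    ∃[ N ] ∀ (n : ℕ) → N ≤ n →
    ∃[ A ] Solves {n} {k} t (CorrectUpToReversal k t) A)
mainTheorem1 = asymmetric-scale , symmetric-scale
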